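{- Let $n\ge 2$ be an integer and let $K_{1,n-1}$ be the star on $n$ vertices. Then $C_{tr}(K_{1,n-1})=2$.
   Context: A set $S\subseteq V$ is a total restrained dominating set (TRD-set) of $G=(V,E)$ if every vertex of $V\setminus S$ is adjacent to at least one vertex of $S$ and to at least one other vertex of $V\setminus S$, and every vertex of $S$ is adjacent to at least one other vertex of $S$. Two disjoint sets $X,Y\subseteq V$ form a total restrained coalition if neither is a TRD-set but $X\cup Y$ is a TRD-set. A trc-partition of $G$ is a partition $\Phi$ of $V$ such that no member of $\Phi$ is a TRD-set and each member forms a total restrained coalition with some other member of $\Phi$. $C_{tr}(G)$ is the maximum cardinality of a trc-partition of $G$. -}

module Defs where

open import Data.Nat using (ℕ; _≤_)
open import Data.Fin using (Fin; toℕ)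
open import Data.Product using (Σ; ∃; _×_)
open import Data.Sum using (_⊎_)
open import Relation.Nullary using (¬_)
open import Relation.Binary.PropositionalEquality using (_≡_; _≢_)
open import Level using (0ℓ)

record Graph (n : ℕ) : Set₁ where
  field
    Adj    : Fin n → Fin n → Set
    sym    : ∀ {u v} → Adj u v → Adj v u
    irrefl : ∀ {v} → ¬ Adj v v
open Graph public

-- Star K_{1,n-1} on vertex set Fin n: vertex 0 is the centre,
-- adjacent to every other vertex; no other edges.
StarAdj : (n : ℕ) → Fin n → Fin n → Set
StarAdj n i j = (toℕ i ≡ 0 × toℕ j ≢ 0) ⊎ (toℕ j ≡ 0 × toℕ i ≢ 0)

star : (n : ℕ) → Graph n
star n = record { Adj = StarAdj n ; sym = s ; irrefl = ir }
  where
  open import Data.Sum using (inj₁; inj₂)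
  open import Data.Product using (_,_)
  s : ∀ {u v} → StarAdj n u v → StarAdj n v u
  s (inj₁ (a , b)) = inj₂ (a , b)
  s (inj₂ (a , b)) = inj₁ (a , b)
  ir : ∀ {v} → ¬ StarAdj n v v
  ir (inj₁ (a , b)) = b a
  ir (inj₂ (a , b)) = b a

VSet : ℕ → Set₁
VSet n = Fin n → Set

_∪_ : ∀ {n} → VSet n → VSet n → VSet n
(X ∪ Y) v = X v ⊎ Y v

IsTRD : ∀ {n} → Graph n → VSet n → Set
IsTRD {n} G S =
  (∀ (v : Fin n) → ¬ S v →
      (∃ λ u → S u × Adj G v u) ×
      (∃ λ w → ¬ S w × w ≢ v × Adj G v w)) ×
  (∀ (v : Fin n) → S v → ∃ λ u → S u × u ≢ v × Adj G v u)

Disjoint : ∀ {n} → VSet n → VSet n → Set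
Disjoint {n} X Y = ∀ (v : Fin n) → X v → Y v → Data.Empty.⊥
  where import Data.Empty

IsTRCoalition : ∀ {n} → Graph n → VSet n → VSet n → Set
IsTRCoalition G X Y =
  Disjoint X Y × ¬ IsTRD G X × ¬ IsTRD G Y × IsTRD G (X ∪ Y)

-- A partition of V = Fin n into k (nonempty) members, given by a
-- surjective class map p : Fin n → Fin k; member c is p ⁻¹ {c}.
member : ∀ {n k} → (Fin n → Fin k) → Fin k → VSet n
member p c v = p v ≡ c

IsPartition : ∀ {n k} → (Fin n → Fin k) → Set
IsPartition {n} {k} p = ∀ (c : Fin k) → ∃ λ (v : Fin n) → p v ≡ c

IsTRCPartition : ∀ {n} → Graph n → (k : ℕ) → (Fin n → Fin k) → Set
IsTRCPartition G k p =
  IsPartition p ×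
  (∀ c → ¬ IsTRD G (member p c)) ×
  (∀ c → ∃ λ d → d ≢ c × IsTRCoalition G (member p c) (member p d))

CtrEq : ∀ {n} → Graph n → ℕ → Set
CtrEq {n} G m =
  (Σ (Fin n → Fin m) λ p → IsTRCPartition G m p) ×
  (∀ (k : ℕ) (p : Fin n → Fin k) → IsTRCPartition G k p → k ≤ m)

-- In a star on at least two vertices the only total restrained dominating set
-- is the whole vertex set: a leaf outside S would need the centre both in S
-- (to be dominated) and outside S (as its neighbour in V ∖ S), and the centre
-- outside S leaves the leaves in S without a neighbour in S.  Hence the union
-- of two members of a trc-partition is all of V, so there are at most two
-- members, and any split into two nonempty parts is a trc-partition.
module Submission where

open import Defs hiding (sym)
open import Data.Nat using (ℕ; _≤_; zero; suc; z≤n; s≤s)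
open import Data.Fin using (Fin; zero; suc)
open import Data.Product using (∃; _×_; _,_)
open import Data.Sum using (_⊎_; inj₁; inj₂)
open import Data.Empty using (⊥; ⊥-elim)
open import Relation.Nullary using (¬_)
open import Relation.Binary.PropositionalEquality using (_≡_; _≢_; refl; sym; trans; subst)

-- Stated with ¬ ¬ since membership in S need not be decidable.
OnlyFullTRD : ∀ {n} → Graph n → Set₁
OnlyFullTRD {n} G = ∀ (S : VSet n) → IsTRD G S → ∀ v → ¬ ¬ S v

NoIsolated : ∀ {n} → Graph n → Set
NoIsolated G = ∀ v → ∃ (Adj G v)

full-isTRD : ∀ {n} (G : Graph n) → NoIsolated G →
             (S : VSet n) → (∀ v → S v) → IsTRD G S
full-isTRD G noIsolated S full =
  (λ v v∉S → ⊥-elim (v∉S (full v))) , inS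
  where
  inS : ∀ v → S v → ∃ λ u → S u × u ≢ v × Adj G v u
  inS v _ with noIsolated v
  ... | u , v~u = u , full u , (λ u≡v → irrefl G (subst (Adj G v) u≡v v~u)) , v~u

other : Fin 2 → Fin 2
other zero = suc zero
other (suc _) = zero

other-≢ : ∀ c → other c ≢ c
other-≢ zero ()
other-≢ (suc zero) ()

≡⊎≡other : ∀ c x → x ≡ c ⊎ x ≡ other c
≡⊎≡other zero zero = inj₁ refl
≡⊎≡other zero (suc zero) = inj₂ refl
≡⊎≡other (suc zero) zero = inj₂ refl
≡⊎≡other (suc zero) (suc zero) = inj₁ refl

bipartition-isTRCPartition : ∀ {n} (G : Graph n) → OnlyFullTRD G → NoIsolated G →
                             (p : Fin n → Fin 2) → IsPartition p → IsTRCPartition G 2 p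
bipartition-isTRCPartition G onlyFull noIsolated p surj =
  surj , member-¬TRD , λ c → other c , other-≢ c , coalition c
  where
  member-¬TRD : ∀ c → ¬ IsTRD G (member p c)
  member-¬TRD c trd with surj (other c)
  ... | v , pv≡other = onlyFull _ trd v λ pv≡c → other-≢ c (trans (sym pv≡other) pv≡c)

  coalition : ∀ c → IsTRCoalition G (member p c) (member p (other c))
  coalition c =
    (λ v pv≡c pv≡other → other-≢ c (trans (sym pv≡other) pv≡c)) ,
    member-¬TRD c , member-¬TRD (other c) ,
    full-isTRD G noIsolated _ (λ v → ≡⊎≡other c (p v))

two-avoided : ∀ {k} (d : Fin (suc (suc (suc k)))) → ∃ λ e → e ≢ zero × e ≢ d
two-avoided zero = suc zero , (λ ()) , (λ ())
two-avoided (suc zero) = suc (suc zero) , (λ ()) , (λ ())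
two-avoided (suc (suc _)) = suc zero , (λ ()) , (λ ())

-- The coalition partner of class 0 leaves out a third class, which is nonempty.
¬trcPartition-3+ : ∀ {n k} (G : Graph n) → OnlyFullTRD G →
                   (p : Fin n → Fin (suc (suc (suc k)))) →
                   ¬ IsTRCPartition G (suc (suc (suc k))) p
¬trcPartition-3+ G onlyFull p (surj , _ , coalitions) with coalitions zero
... | d , _ , (_ , _ , _ , union-trd) with two-avoided d
... | e , e≢0 , e≢d with surj e
... | v , pv≡e = onlyFull _ union-trd v λ
  { (inj₁ pv≡0) → e≢0 (trans (sym pv≡e) pv≡0)
  ; (inj₂ pv≡d) → e≢d (trans (sym pv≡e) pv≡d)
  }

trcPartition-size≤2 : ∀ {n} (G : Graph n) → OnlyFullTRD G →
                      ∀ k (p : Fin n → Fin k) → IsTRCPartition G k p → k ≤ 2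
trcPartition-size≤2 G onlyFull zero p _ = z≤n
trcPartition-size≤2 G onlyFull (suc zero) p _ = s≤s z≤n
trcPartition-size≤2 G onlyFull (suc (suc zero)) p _ = s≤s (s≤s z≤n)
trcPartition-size≤2 G onlyFull (suc (suc (suc k))) p trc = ⊥-elim (¬trcPartition-3+ G onlyFull p trc)

star-leaf-neighbour≡centre : ∀ {n} {x : Fin n} {u : Fin (suc n)} →
                             StarAdj (suc n) (suc x) u → u ≡ zero
star-leaf-neighbour≡centre (inj₁ (() , _))
star-leaf-neighbour≡centre {u = zero} (inj₂ _) = refl
star-leaf-neighbour≡centre {u = suc _} (inj₂ (() , _))

star-noIsolated : ∀ {m} → NoIsolated (star (suc (suc m)))
star-noIsolated zero = suc zero , inj₁ (refl , λ ())
star-noIsolated (suc _) = zero , inj₂ (refl , λ ())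

star-onlyFullTRD : ∀ {m} → OnlyFullTRD (star (suc (suc m)))
star-onlyFullTRD S (dominated , total) = full
  where
  leaf-in : ∀ x → ¬ ¬ S (suc x)
  leaf-in x x∉S with dominated (suc x) x∉S
  ... | (u , u∈S , x~u) , (w , w∉S , _ , x~w) =
    w∉S (subst S (trans (star-leaf-neighbour≡centre x~u)
                        (sym (star-leaf-neighbour≡centre x~w))) u∈S)

  full : ∀ v → ¬ ¬ S v
  full (suc x) = leaf-in x
  full zero 0∉S = leaf-in zero λ 1∈S → centre-in (total (suc zero) 1∈S)
    where
    centre-in : ∃ (λ u → S u × u ≢ suc zero × StarAdj _ (suc zero) u) → ⊥
    centre-in (u , u∈S , _ , 1~u) = 0∉S (subst S (star-leaf-neighbour≡centre 1~u) u∈S)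

centreOrLeaf : ∀ {m} → Fin (suc (suc m)) → Fin 2
centreOrLeaf zero = zero
centreOrLeaf (suc _) = suc zero

centreOrLeaf-isPartition : ∀ {m} → IsPartition (centreOrLeaf {m})
centreOrLeaf-isPartition zero = zero , refl
centreOrLeaf-isPartition (suc zero) = suc zero , refl

mainTheorem12 : ∀ (n : ℕ) → 2 ≤ n → CtrEq (star n) 2
mainTheorem12 (suc (suc m)) (s≤s (s≤s z≤n)) =
  (centreOrLeaf ,
   bipartition-isTRCPartition (star _) star-onlyFullTRD star-noIsolated
                              centreOrLeaf centreOrLeaf-isPartition) ,
  trcPartition-size≤2 (star _) star-onlyFullTRD
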